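{- Let $w\ge 2$ be an integer. The diameter of the Cards in Piles graph $G(w,2,w-1,w-1,1)$ is at least $(w^2-1)/4$.
   Context: Cards in Piles graph $G(w,s,m_0,\ldots,m_s)$: there is a set $W$ of $w$ distinct cards and $s+1$ piles numbered $0,\ldots,s$. A state is a tuple $(P_0,\ldots,P_s)$ of ordered subsets of $W$ (each read from bottom to top) that partition $W$, with $|P_i|\le m_i$ for each $i$. A move takes the top card of one pile and places it on top of another pile, provided no pile $i$ then has more than $m_i$ cards. The graph has the states as vertices and moves as edges. Thus $G(w,2,w-1,w-1,1)$ has three piles, of capacities $w-1$, $w-1$ and $1$. -}

module Defs where

open import Data.Nat using (ℕ; zero; suc; _≤_; _*_; _∸_)
open import Data.Fin using (Fin)
import Data.Fin as F
open import Data.List using (List; length; _++_; _∷ʳ_)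
open import Data.List.Membership.Propositional using (_∈_)
open import Data.List.Relation.Unary.Unique.Propositional using (Unique)
open import Data.Product using (Σ; _×_; ∃; ∃-syntax)
open import Relation.Binary.PropositionalEquality using (_≡_; _≢_)

-- A configuration of the Cards in Piles graph G(w,s,m_0,...,m_s):
-- cards are Fin w, piles are indexed by Fin (suc s), and each pile is a
-- list of cards read from bottom to top (the last element is the top card).
Config : ℕ → ℕ → Set
Config w s = Fin (suc s) → List (Fin w)

allCards : ∀ {w} s → Config w s → List (Fin w)
allCards zero    P = P F.zero
allCards (suc s) P = P F.zero ++ allCards s (λ i → P (F.suc i))

IsState : ∀ {w s} → (Fin (suc s) → ℕ) → Config w s → Set
IsState {w} {s} m P =
  ((c : Fin w) → c ∈ allCards s P) × Unique (allCards s P)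
  × ((i : Fin (suc s)) → length (P i) ≤ m i)

Move : ∀ {w s} → Config w s → Config w s → Set
Move {w} {s} P Q =
  Σ (Fin (suc s)) λ i → Σ (Fin (suc s)) λ j → i ≢ j ×
  (Σ (Fin w) λ c → Σ (List (Fin w)) λ xs →
     (P i ≡ xs ∷ʳ c) × (Q i ≡ xs) × (Q j ≡ P j ∷ʳ c) ×
     ((k : Fin (suc s)) → k ≢ i → k ≢ j → Q k ≡ P k))

data Walk {w s} (m : Fin (suc s) → ℕ) : ℕ → Config w s → Config w s → Set where
  here : ∀ {P} → IsState m P → Walk m 0 P P
  step : ∀ {n P Q R} → IsState m P → Move P Q → Walk m n Q R → Walk m (suc n) P R

-- The diameter of G(w,s,m) is at least the rational number a/b (b > 0):
-- there are two states P, Q such that every walk from P to Q has length n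
-- with a/b ≤ n, i.e. a ≤ b * n (if no walk exists the distance is infinite).
DiameterAtLeast : (w s : ℕ) → (Fin (suc s) → ℕ) → (a b : ℕ) → Set
DiameterAtLeast w s m a b =
  Σ (Config w s) λ P → Σ (Config w s) λ Q →
    IsState m P × IsState m Q × ((n : ℕ) → Walk m n P Q → a ≤ b * n)

caps : ℕ → Fin 3 → ℕ
caps w F.zero = w ∸ 1
caps w (F.suc F.zero) = w ∸ 1
caps w (F.suc (F.suc F.zero)) = 1

-- Read the cards of a state as one word: up pile 0, then pile 2, then down pile 1.  As pile 2
-- holds at most one card, a move changes this word by at most one adjacent transposition, so for
-- any true/false labelling of the cards the number of inversions (a true before a false) grows
-- by at most one per move.  Put card 0 alone on pile 2 and the other w − 1 = b + a cards in
-- order on pile 1 (start) or on pile 0 (target), labelling the lowest b of them true and all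
-- others false: the start word is sorted, the target word has b (a + 1) inversions, and an even
-- split of b + a makes b (a + 1) = ⌊w/2⌋ ⌈w/2⌉ ≥ (w² − 1)/4.
module Submission where

open import Defs
open import Data.Nat using (ℕ; zero; suc; _+_; _*_; _∸_; _≤_; _<ᵇ_; z≤n; s≤s)
open import Data.Nat.Properties
  using (module ≤-Reasoning; ≤-refl; ≤-reflexive; ≤-trans; n≤1+n; m≤n⇒m≤1+n; +-suc; +-identityʳ; +-monoʳ-≤; *-monoʳ-≤; m∸n≤m)
open import Data.Nat.Tactic.RingSolver using (solve-∀)
open import Data.Bool using (Bool; true; false)
open import Data.Fin using (Fin; toℕ)
import Data.Fin as F
open import Data.List using (List; []; _∷_; _++_; _∷ʳ_; reverse; length; map; tabulate; replicate)
open import Data.List.Properties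
  using (++-assoc; map-++; reverse-++; reverse-map; map-tabulate; length-tabulate; unfold-reverse)
open import Data.List.Membership.Propositional using (_∈_)
open import Data.List.Membership.Propositional.Properties using (∈-allFin)
open import Data.List.Relation.Unary.Unique.Propositional using (Unique)
open import Data.List.Relation.Unary.Unique.Propositional.Properties using (allFin⁺)
open import Data.Product using (∃-syntax; _,_)
open import Data.Sum using (_⊎_; inj₁; inj₂)
open import Data.Empty using (⊥-elim)
open import Relation.Binary.PropositionalEquality
open import Relation.Binary.PropositionalEquality.Properties using (setoid)
import Data.List.Relation.Binary.Permutation.Setoid.Properties as Permutation

data AtMostOneSwap {A : Set} : List A → List A → Set where
  unchanged : ∀ {xs} → AtMostOneSwap xs xs
  swap      : ∀ pre x y post → AtMostOneSwap (pre ++ x ∷ y ∷ post) (pre ++ y ∷ x ∷ post)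

AtMostOneSwap-reflexive : ∀ {A : Set} {xs ys : List A} → xs ≡ ys → AtMostOneSwap xs ys
AtMostOneSwap-reflexive refl = unchanged

AtMostOneSwap-sym : ∀ {A : Set} {xs ys : List A} → AtMostOneSwap xs ys → AtMostOneSwap ys xs
AtMostOneSwap-sym unchanged           = unchanged
AtMostOneSwap-sym (swap pre x y post) = swap pre y x post

AtMostOneSwap-map : ∀ {A B : Set} (f : A → B) {xs ys : List A} →
                    AtMostOneSwap xs ys → AtMostOneSwap (map f xs) (map f ys)
AtMostOneSwap-map f unchanged = unchanged
AtMostOneSwap-map f (swap pre x y post)
  rewrite map-++ f pre (x ∷ y ∷ post) | map-++ f pre (y ∷ x ∷ post) =
  swap (map f pre) (f x) (f y) (map f post)

swap-across : ∀ {A : Set} pre (x : A) C post → length C ≤ 1 →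
              AtMostOneSwap (pre ++ x ∷ C ++ post) (pre ++ C ++ x ∷ post)
swap-across pre x []          post _         = unchanged
swap-across pre x (y ∷ [])    post _         = swap pre x y post
swap-across pre x (_ ∷ _ ∷ _) post (s≤s ())

falses : List Bool → ℕ
falses []           = 0
falses (true  ∷ bs) = falses bs
falses (false ∷ bs) = suc (falses bs)

inversions : List Bool → ℕ
inversions []           = 0
inversions (true  ∷ bs) = falses bs + inversions bs
inversions (false ∷ bs) = inversions bs

falses-++ : ∀ bs cs → falses (bs ++ cs) ≡ falses bs + falses cs
falses-++ []           cs = refl
falses-++ (true  ∷ bs) cs = falses-++ bs cs
falses-++ (false ∷ bs) cs = cong suc (falses-++ bs cs)

falses-swap : ∀ pre x y post → falses (pre ++ x ∷ y ∷ post) ≡ falses (pre ++ y ∷ x ∷ post)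
falses-swap []           true  true  post = refl
falses-swap []           true  false post = refl
falses-swap []           false true  post = refl
falses-swap []           false false post = refl
falses-swap (true  ∷ pre) x y post = falses-swap pre x y post
falses-swap (false ∷ pre) x y post = cong suc (falses-swap pre x y post)

inversions-swap : ∀ pre x y post →
                  inversions (pre ++ y ∷ x ∷ post) ≤ 1 + inversions (pre ++ x ∷ y ∷ post)
inversions-swap []           true  true  post = n≤1+n _
inversions-swap []           true  false post = m≤n⇒m≤1+n (n≤1+n _)
inversions-swap []           false true  post = ≤-refl
inversions-swap []           false false post = n≤1+n _
inversions-swap (false ∷ pre) x y post = inversions-swap pre x y post
inversions-swap (true  ∷ pre) x y post
  rewrite falses-swap pre y x post =
  ≤-trans (+-monoʳ-≤ (falses (pre ++ x ∷ y ∷ post)) (inversions-swap pre x y post))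
          (≤-reflexive (+-suc _ _))

inversions-AtMostOneSwap : ∀ {bs cs} → AtMostOneSwap bs cs → inversions cs ≤ 1 + inversions bs
inversions-AtMostOneSwap unchanged           = n≤1+n _
inversions-AtMostOneSwap (swap pre x y post) = inversions-swap pre x y post


falses-replicate-true : ∀ n → falses (replicate n true) ≡ 0
falses-replicate-true zero    = refl
falses-replicate-true (suc n) = falses-replicate-true n

falses-replicate-false : ∀ n → falses (replicate n false) ≡ n
falses-replicate-false zero    = refl
falses-replicate-false (suc n) = cong suc (falses-replicate-false n)

inversions-replicate-false : ∀ n → inversions (replicate n false) ≡ 0
inversions-replicate-false zero    = refl
inversions-replicate-false (suc n) = inversions-replicate-false n

inversions-sorted : ∀ a b → inversions (replicate a false ++ replicate b true) ≡ 0
inversions-sorted (suc a) b       = inversions-sorted a b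
inversions-sorted zero    zero    = refl
inversions-sorted zero    (suc b) = cong₂ _+_ (falses-replicate-true b) (inversions-sorted zero b)

inversions-antisorted : ∀ b c → inversions (replicate b true ++ replicate c false) ≡ b * c
inversions-antisorted zero    c = inversions-replicate-false c
inversions-antisorted (suc b) c = cong₂ _+_ falses-suffix (inversions-antisorted b c)
  where
  falses-suffix : falses (replicate b true ++ replicate c false) ≡ c
  falses-suffix = begin
    falses (replicate b true ++ replicate c false)        ≡⟨ falses-++ (replicate b true) _ ⟩
    falses (replicate b true) + falses (replicate c false) ≡⟨ cong₂ _+_ (falses-replicate-true b) (falses-replicate-false c) ⟩
    c                                                      ∎
    where open ≡-Reasoning

replicate-∷ʳ : ∀ {A : Set} n (x : A) → replicate n x ∷ʳ x ≡ replicate (suc n) x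
replicate-∷ʳ zero    x = refl
replicate-∷ʳ (suc n) x = cong (x ∷_) (replicate-∷ʳ n x)

reverse-replicate : ∀ {A : Set} n (x : A) → reverse (replicate n x) ≡ replicate n x
reverse-replicate zero    x = refl
reverse-replicate (suc n) x = begin
  reverse (x ∷ replicate n x) ≡⟨ unfold-reverse x (replicate n x) ⟩
  reverse (replicate n x) ∷ʳ x ≡⟨ cong (_∷ʳ x) (reverse-replicate n x) ⟩
  replicate n x ∷ʳ x           ≡⟨ replicate-∷ʳ n x ⟩
  replicate (suc n) x          ∎
  where open ≡-Reasoning

tabulate-const : ∀ {A : Set} n (x : A) → tabulate {n = n} (λ _ → x) ≡ replicate n x
tabulate-const zero    x = refl
tabulate-const (suc n) x = cong (x ∷_) (tabulate-const n x)

tabulate-<ᵇ : ∀ b a → tabulate {n = b + a} (λ i → toℕ i <ᵇ b) ≡ replicate b true ++ replicate a false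
tabulate-<ᵇ zero    a = tabulate-const a false
tabulate-<ᵇ (suc b) a = cong (true ∷_) (tabulate-<ᵇ b a)

pattern pile₀ = F.zero
pattern pile₁ = F.suc F.zero
pattern pile₂ = F.suc (F.suc F.zero)

piles : ∀ {w} → List (Fin w) → List (Fin w) → List (Fin w) → Config w 2
piles A B C pile₀ = A
piles A B C pile₁ = B
piles A B C pile₂ = C

line : ∀ {w} → Config w 2 → List (Fin w)
line P = P pile₀ ++ P pile₂ ++ reverse (P pile₁)

∷ʳ-length≤1 : ∀ {A : Set} {xs : List A} {x} → length (xs ∷ʳ x) ≤ 1 → xs ≡ []
∷ʳ-length≤1 {xs = []}        _        = refl
∷ʳ-length≤1 {xs = _ ∷ []}    (s≤s ())
∷ʳ-length≤1 {xs = _ ∷ _ ∷ _} (s≤s ())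

reverse-∷ʳ : ∀ {A : Set} (xs : List A) x → reverse (xs ∷ʳ x) ≡ x ∷ reverse xs
reverse-∷ʳ xs x = reverse-++ xs (x ∷ [])

swap-across-line : ∀ {A : Set} xs (c : A) C B → length C ≤ 1 →
                   AtMostOneSwap ((xs ∷ʳ c) ++ C ++ reverse B) (xs ++ C ++ reverse (B ∷ʳ c))
swap-across-line xs c C B C≤1
  rewrite ++-assoc xs (c ∷ []) (C ++ reverse B) | reverse-∷ʳ B c = swap-across xs c C (reverse B) C≤1

line-move : ∀ {w} {P Q : Config w 2} → length (P pile₂) ≤ 1 → length (Q pile₂) ≤ 1 →
            Move P Q → AtMostOneSwap (line P) (line Q)
line-move _ _ (pile₀ , pile₀ , i≢j , _) = ⊥-elim (i≢j refl)
line-move _ _ (pile₁ , pile₁ , i≢j , _) = ⊥-elim (i≢j refl)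
line-move _ _ (pile₂ , pile₂ , i≢j , _) = ⊥-elim (i≢j refl)
line-move {P = P} P₂≤1 _ (pile₀ , pile₁ , _ , c , xs , Pi , Qi , Qj , others)
  rewrite Pi | Qi | Qj | others pile₂ (λ ()) (λ ()) =
  swap-across-line xs c (P pile₂) (P pile₁) P₂≤1
line-move {P = P} P₂≤1 _ (pile₁ , pile₀ , _ , c , xs , Pi , Qi , Qj , others)
  rewrite Pi | Qi | Qj | others pile₂ (λ ()) (λ ()) =
  AtMostOneSwap-sym (swap-across-line (P pile₀) c (P pile₂) xs P₂≤1)
line-move {P = P} _ Q₂≤1 (pile₀ , pile₂ , _ , c , xs , Pi , Qi , Qj , others)
  rewrite Pi | Qi | Qj | others pile₁ (λ ()) (λ ()) | ∷ʳ-length≤1 {xs = P pile₂} {x = c} Q₂≤1 =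
  AtMostOneSwap-reflexive (++-assoc xs (c ∷ []) (reverse (P pile₁)))
line-move {P = P} P₂≤1 _ (pile₂ , pile₀ , _ , c , xs , Pi , Qi , Qj , others)
  rewrite Pi | Qi | Qj | others pile₁ (λ ()) (λ ()) | ∷ʳ-length≤1 {xs = xs} {x = c} P₂≤1 =
  AtMostOneSwap-reflexive (sym (++-assoc (P pile₀) (c ∷ []) (reverse (P pile₁))))
line-move {P = P} _ Q₂≤1 (pile₁ , pile₂ , _ , c , xs , Pi , Qi , Qj , others)
  rewrite Pi | Qi | Qj | others pile₀ (λ ()) (λ ()) | ∷ʳ-length≤1 {xs = P pile₂} {x = c} Q₂≤1 =
  AtMostOneSwap-reflexive (cong (P pile₀ ++_) (reverse-∷ʳ xs c))
line-move {P = P} P₂≤1 _ (pile₂ , pile₁ , _ , c , xs , Pi , Qi , Qj , others)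
  rewrite Pi | Qi | Qj | others pile₀ (λ ()) (λ ()) | ∷ʳ-length≤1 {xs = xs} {x = c} P₂≤1 =
  AtMostOneSwap-reflexive (cong (P pile₀ ++_) (sym (reverse-∷ʳ (P pile₁) c)))

module _ {w} (label : Fin w → Bool) where

  potential : Config w 2 → ℕ
  potential P = inversions (map label (line P))

  potential-move : ∀ {P Q} → length (P pile₂) ≤ 1 → length (Q pile₂) ≤ 1 →
                   Move P Q → potential Q ≤ 1 + potential P
  potential-move P₂≤1 Q₂≤1 mv =
    inversions-AtMostOneSwap (AtMostOneSwap-map label (line-move P₂≤1 Q₂≤1 mv))

  module _ {m : Fin 3 → ℕ} (m₂≤1 : m pile₂ ≤ 1) where

    pile₂-length : ∀ {P : Config w 2} → IsState m P → length (P pile₂) ≤ 1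
    pile₂-length (_ , _ , bounded) = ≤-trans (bounded pile₂) m₂≤1

    walk-source : ∀ {n} {P R : Config w 2} → Walk m n P R → IsState m P
    walk-source (here sP)     = sP
    walk-source (step sP _ _) = sP

    potential-walk : ∀ {n} {P R : Config w 2} → Walk m n P R → potential R ≤ n + potential P
    potential-walk (here _) = ≤-refl
    potential-walk {suc n} {P} {R} (step {Q = Q} sP mv walk) = begin
      potential R             ≤⟨ potential-walk walk ⟩
      n + potential Q         ≤⟨ +-monoʳ-≤ n (potential-move {P} {Q} P₂≤1 Q₂≤1 mv) ⟩
      n + (1 + potential P)   ≡⟨ +-suc n (potential P) ⟩
      suc n + potential P     ∎
      where
      open ≤-Reasoning
      P₂≤1 : length (P pile₂) ≤ 1
      P₂≤1 = pile₂-length {P} sP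
      Q₂≤1 : length (Q pile₂) ≤ 1
      Q₂≤1 = pile₂-length {Q} (walk-source walk)

module Reversal (b a : ℕ) where

  open Permutation (setoid (Fin (suc (b + a)))) using (∈-resp-↭; Unique-resp-↭; ∷↭∷ʳ)

  label : Fin (suc (b + a)) → Bool
  label F.zero    = false
  label (F.suc i) = toℕ i <ᵇ b

  stack : List (Fin (suc (b + a)))
  stack = tabulate F.suc

  start target : Config (suc (b + a)) 2
  start  = piles [] stack (F.zero ∷ [])
  target = piles stack [] (F.zero ∷ [])

  length-stack : length stack ≡ b + a
  length-stack = length-tabulate F.suc

  cards-complete : ∀ c → c ∈ stack ∷ʳ F.zero
  cards-complete c = ∈-resp-↭ (∷↭∷ʳ F.zero stack) (∈-allFin c)

  cards-unique : Unique (stack ∷ʳ F.zero)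
  cards-unique = Unique-resp-↭ (∷↭∷ʳ F.zero stack) (allFin⁺ (suc (b + a)))

  start-state : IsState (caps (suc (b + a))) start
  start-state = cards-complete , cards-unique , bounded
    where
    bounded : ∀ i → length (start i) ≤ caps (suc (b + a)) i
    bounded pile₀ = z≤n
    bounded pile₁ = ≤-reflexive length-stack
    bounded pile₂ = ≤-refl

  target-state : IsState (caps (suc (b + a))) target
  target-state = cards-complete , cards-unique , bounded
    where
    bounded : ∀ i → length (target i) ≤ caps (suc (b + a)) i
    bounded pile₀ = ≤-reflexive length-stack
    bounded pile₁ = z≤n
    bounded pile₂ = ≤-refl

  label-stack : map label stack ≡ replicate b true ++ replicate a false
  label-stack = trans (map-tabulate F.suc label) (tabulate-<ᵇ b a)

  potential-start : potential label start ≡ 0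
  potential-start = begin
    inversions (map label (reverse stack))
      ≡⟨ cong inversions (reverse-map label stack) ⟩
    inversions (reverse (map label stack))
      ≡⟨ cong (λ bs → inversions (reverse bs)) label-stack ⟩
    inversions (reverse (replicate b true ++ replicate a false))
      ≡⟨ cong inversions (reverse-++ (replicate b true) (replicate a false)) ⟩
    inversions (reverse (replicate a false) ++ reverse (replicate b true))
      ≡⟨ cong₂ (λ fs ts → inversions (fs ++ ts)) (reverse-replicate a false) (reverse-replicate b true) ⟩
    inversions (replicate a false ++ replicate b true)
      ≡⟨ inversions-sorted a b ⟩
    0 ∎
    where open ≡-Reasoning

  potential-target : potential label target ≡ b * suc a
  potential-target = begin
    inversions (map label (stack ++ F.zero ∷ []))
      ≡⟨ cong inversions (map-++ label stack (F.zero ∷ [])) ⟩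
    inversions (map label stack ∷ʳ false)
      ≡⟨ cong (λ bs → inversions (bs ∷ʳ false)) label-stack ⟩
    inversions ((replicate b true ++ replicate a false) ∷ʳ false)
      ≡⟨ cong inversions (++-assoc (replicate b true) (replicate a false) (false ∷ [])) ⟩
    inversions (replicate b true ++ replicate a false ∷ʳ false)
      ≡⟨ cong (λ fs → inversions (replicate b true ++ fs)) (replicate-∷ʳ a false) ⟩
    inversions (replicate b true ++ replicate (suc a) false)
      ≡⟨ inversions-antisorted b (suc a) ⟩
    b * suc a ∎
    where open ≡-Reasoning

  walk-length : ∀ {n} → Walk (caps (suc (b + a))) n start target → b * suc a ≤ n
  walk-length {n} walk =
    subst₂ _≤_ potential-target (trans (cong (n +_) potential-start) (+-identityʳ n))
           (potential-walk label ≤-refl walk)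

caps-diameter-≥ : ∀ b a {t q} → t ≤ q * (b * suc a) →
                  DiameterAtLeast (suc (b + a)) 2 (caps (suc (b + a))) t q
caps-diameter-≥ b a {q = q} t≤ =
  start , target , start-state , target-state ,
  λ n walk → ≤-trans t≤ (*-monoʳ-≤ q (walk-length walk))
  where open Reversal b a

even-or-odd : ∀ n → ∃[ k ] (n ≡ k + k ⊎ n ≡ suc (k + k))
even-or-odd zero = zero , inj₁ refl
even-or-odd (suc n) with even-or-odd n
... | k , inj₁ refl = k , inj₂ refl
... | k , inj₂ refl = suc k , inj₁ (cong suc (sym (+-suc k k)))

odd-square : ∀ k → suc (k + k) * suc (k + k) ≡ suc (4 * (k * suc k))
odd-square = solve-∀

even-square : ∀ k → suc (suc k + k) * suc (suc k + k) ≡ 4 * (suc k * suc k)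
even-square = solve-∀

lemma5 : (w : ℕ) → 2 ≤ w → DiameterAtLeast w 2 (caps w) (w * w ∸ 1) 4
lemma5 zero    ()
lemma5 (suc v) _ with even-or-odd v
... | k , inj₁ refl = caps-diameter-≥ k k {q = 4} (≤-reflexive (cong (_∸ 1) (odd-square k)))
... | k , inj₂ refl = caps-diameter-≥ (suc k) k {q = 4} (≤-trans (m∸n≤m _ 1) (≤-reflexive (even-square k)))
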